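{- For each $n\geq 1$, the number of closed polygons in the $n$-th Schreier graph $\Sigma_n$ of the Hanoi Towers group $H^{(3)}$ (with loops removed) is $2^{\frac{3^n-1}{2}}$.
   Context: Vertices of the rooted ternary tree are finite words over $\{0,1,2\}$. The Hanoi Towers group $H^{(3)}$ is generated by the involutions $a,b,c$ defined recursively by $a(0w)=1w$, $a(1w)=0w$, $a(2w)=2a(w)$; $b(0w)=2w$, $b(2w)=0w$, $b(1w)=1b(w)$; $c(1w)=2w$, $c(2w)=1w$, $c(0w)=0c(w)$ (and all fix the empty word). Its $n$-th Schreier graph $\Sigma_n$ has vertex set the $3^n$ words of length $n$ over $\{0,1,2\}$, and for each $s\in\{a,b,c\}$ and each pair $\{u,s(u)\}$ with $u\neq s(u)$ one edge joining $u$ and $s(u)$, labeled $s$; the loops (at $0^n,1^n,2^n$) are removed. A closed polygon of a finite graph is a subset of its edge set in which every vertex has even degree (the empty set included). -}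

module Defs where

open import Data.Bool using (Bool; true; false; _∧_; _∨_; _xor_; if_then_else_; not)
open import Data.Nat using (ℕ; zero; suc; _<ᵇ_)
open import Data.Fin using (Fin; zero; suc; toℕ)
import Data.Fin as Fin
open import Data.Vec using (Vec; []; _∷_)
open import Data.Vec.Properties using (≡-dec)
open import Data.List using (List; []; _∷_; map; concatMap; allFin; filterᵇ; length; zip; foldr)
open import Data.Product using (_×_; _,_)
open import Relation.Nullary.Decidable using (does)

-- Vertices of level n of the ternary tree: words of length n over {0,1,2}.
Word : ℕ → Set
Word n = Vec (Fin 3) n

data Gen : Set where
  a b c : Gen

pattern 𝟘 = zero
pattern 𝟙 = suc zero
pattern 𝟚 = suc (suc zero)

act : ∀ {n} → Gen → Word n → Word n
act s [] = []
act a (𝟘 ∷ w) = 𝟙 ∷ w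
act a (𝟙 ∷ w) = 𝟘 ∷ w
act a (𝟚 ∷ w) = 𝟚 ∷ act a w
act b (𝟘 ∷ w) = 𝟚 ∷ w
act b (𝟚 ∷ w) = 𝟘 ∷ w
act b (𝟙 ∷ w) = 𝟙 ∷ act b w
act c (𝟙 ∷ w) = 𝟚 ∷ w
act c (𝟚 ∷ w) = 𝟙 ∷ w
act c (𝟘 ∷ w) = 𝟘 ∷ act c w

_==w_ : ∀ {n} → Word n → Word n → Bool
u ==w v = does (≡-dec Fin._≟_ u v)

-- Strict lexicographic order on words (used only to pick one
-- representative of each unordered pair {u, s(u)}).
_<w_ : ∀ {n} → Word n → Word n → Bool
[] <w [] = false
(x ∷ xs) <w (y ∷ ys) =
  if toℕ x <ᵇ toℕ y then true
  else (if does (x Fin.≟ y) then xs <w ys else false)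

allWords : ∀ n → List (Word n)
allWords zero = [] ∷ []
allWords (suc n) = concatMap (λ x → map (x ∷_) (allWords n)) (allFin 3)

gens : List Gen
gens = a ∷ b ∷ c ∷ []

-- Edges of Σ_n: one edge labelled s for each pair {u, s(u)} with u ≠ s(u);
-- represented by (s , u) with u <lex s(u) (so loops are excluded and each
-- unordered pair is listed once per label).
Edge : ℕ → Set
Edge n = Gen × Word n

edges : ∀ n → List (Edge n)
edges n = filterᵇ (λ { (s , u) → u <w act s u })
                  (concatMap (λ s → map (s ,_) (allWords n)) gens)

incident : ∀ {n} → Word n → Edge n → Bool
incident v (s , u) = (v ==w u) ∨ (v ==w act s u)

allSubsets : ℕ → List (List Bool)
allSubsets zero = [] ∷ []
allSubsets (suc m) = concatMap (λ x → map (x ∷_) (allSubsets m)) (true ∷ false ∷ [])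

oddDegree : ∀ {n} → Word n → List (Bool × Edge n) → Bool
oddDegree v = foldr (λ { (sel , e) acc → (sel ∧ incident v e) xor acc }) false

allᵇ : ∀ {A : Set} → (A → Bool) → List A → Bool
allᵇ p = foldr (λ x acc → p x ∧ acc) true

-- A subset of the edge set (given by its indicator list aligned with
-- edges n) is a closed polygon iff every vertex has even degree.
isClosedPolygon : ∀ n → List Bool → Bool
isClosedPolygon n S = allᵇ (λ v → not (oddDegree v (zip S (edges n)))) (allWords n)

-- Number of closed polygons of Σ_n (empty set included).
numClosedPolygons : ℕ → ℕ
numClosedPolygons n =
  length (filterᵇ (isClosedPolygon n) (allSubsets (length (edges n))))

-- A closed polygon is a set of edges with zero boundary over 𝔽₂. The graph Σₙ₊₁ is made of
-- three blocks 0Σₙ, 1Σₙ, 2Σₙ joined by three perfect matchings (0–1, 0–2, 1–2), and each block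
-- carries a copy of the edges of Σₙ of one label. Choose the 0–1 matching edges freely
-- (2^(3ⁿ) ways) and the copied edges arbitrarily: then the parity conditions at block 1
-- determine the 1–2 matching edges and those at block 0 the 0–2 ones, and what remains of the
-- condition at block 2 says exactly that the three copies together form a closed polygon of Σₙ.
-- So the count is multiplied by 2^(3ⁿ) at each level, giving 2^(1 + 3 + ⋯ + 3ⁿ⁻¹) = 2^((3ⁿ − 1)/2).

module Submission where

open import Defs
open import Data.Nat using (ℕ; _≤_; _^_; _∸_; _/_)
open import Relation.Binary.PropositionalEquality using (_≡_)

open import Algebra.Bundles using (CommutativeRing; CommutativeMonoid)
open import Data.Bool using (Bool; true; false; _∧_; _∨_; _xor_; not; T?)
open import Data.Bool.Properties
  using (xor-∧-commutativeRing; xor-same; xor-comm; xor-assoc; xor-identityʳ;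
         ∨-identityʳ; ∧-identityʳ; ∧-zeroʳ; ∧-assoc)
open import Algebra.Properties.CommutativeSemigroup
  (CommutativeMonoid.commutativeSemigroup (CommutativeRing.+-commutativeMonoid xor-∧-commutativeRing))
  using (x∙yz≈y∙xz; x∙yz≈z∙xy) renaming (interchange to xor-interchange)
open import Data.Fin using (Fin; _≟_)
open import Data.List using (List; []; _∷_; _++_; map; filterᵇ; length; zip)
open import Data.List.Properties using (map-++; map-∘; length-++; length-map; ++-assoc; filter-all; filter-none)
open import Data.List.Relation.Unary.All using (universal)
open import Data.Nat using (zero; suc; _+_; _*_)
open import Data.Nat.DivMod using (m*n/n≡m)
open import Data.Nat.ListAction using (sum)
open import Data.Nat.Properties
  using (+-identityʳ; +-assoc; *-identityˡ; *-assoc; *-distribˡ-+; ^-distribˡ-+-*; +-commutativeSemigroup)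
open import Algebra.Properties.CommutativeSemigroup +-commutativeSemigroup using (interchange)
open import Data.Nat.Tactic.RingSolver using (solve-∀)
open import Data.Product using (_×_; _,_; map₂)
open import Data.Unit using (tt)
open import Data.Vec using ([]; _∷_; lookup)
open import Function using (_∘_)
open import Relation.Binary.PropositionalEquality using (refl; sym; trans; cong; cong₂; module ≡-Reasoning)
open import Relation.Nullary.Decidable using (does)

private variable
  A B : Set
  n : ℕ

indicator : Bool → ℕ
indicator true  = 1
indicator false = 0

indicator-∧ : ∀ x y → indicator (x ∧ y) ≡ indicator x * indicator y
indicator-∧ true  y = sym (*-identityˡ (indicator y))
indicator-∧ false y = refl

indicator-∧-* : ∀ x y k → indicator (x ∧ y) * k ≡ indicator x * (indicator y * k)
indicator-∧-* true  y k = sym (+-identityʳ (indicator y * k))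
indicator-∧-* false y k = refl

xor-cancel : ∀ x y z → (x xor z) xor (x xor y) ≡ y xor z
xor-cancel x y z = trans (xor-interchange x z x y) (trans (cong (_xor (z xor y)) (xor-same x)) (xor-comm z y))

allᵇ-cong : ∀ {p q : A → Bool} xs → (∀ x → p x ≡ q x) → allᵇ p xs ≡ allᵇ q xs
allᵇ-cong []       p≗q = refl
allᵇ-cong (x ∷ xs) p≗q = cong₂ _∧_ (p≗q x) (allᵇ-cong xs p≗q)

allᵇ-map-++ : ∀ (p : B → Bool) (f : A → B) xs ys →
  allᵇ p (map f xs ++ ys) ≡ allᵇ (p ∘ f) xs ∧ allᵇ p ys
allᵇ-map-++ p f []       ys = refl
allᵇ-map-++ p f (x ∷ xs) ys = trans (cong (p (f x) ∧_) (allᵇ-map-++ p f xs ys)) (sym (∧-assoc (p (f x)) _ _))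

filterᵇ-map-++ : ∀ (p : B → Bool) (f : A → B) xs ys →
  filterᵇ p (map f xs ++ ys) ≡ map f (filterᵇ (p ∘ f) xs) ++ filterᵇ p ys
filterᵇ-map-++ p f []       ys = refl
filterᵇ-map-++ p f (x ∷ xs) ys with p (f x)
... | true  = cong (f x ∷_) (filterᵇ-map-++ p f xs ys)
... | false = filterᵇ-map-++ p f xs ys

filterᵇ-true : ∀ (xs : List A) → filterᵇ (λ _ → true) xs ≡ xs
filterᵇ-true xs = filter-all (T? ∘ λ _ → true) (universal (λ _ → tt) xs)

filterᵇ-false : ∀ (xs : List A) → filterᵇ (λ _ → false) xs ≡ []
filterᵇ-false xs = filter-none (T? ∘ λ _ → false) (universal (λ _ ()) xs)

length-map-++ : ∀ (f : A → B) xs ys → length (map f xs ++ ys) ≡ length xs + length ys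
length-map-++ f xs ys = trans (length-++ (map f xs)) (cong (_+ length ys) (length-map f xs))

map-map-++-map : ∀ {C : Set} (f : B → C) (g h : A → B) xs ys zs →
  map f (map g xs ++ (map h ys ++ [])) ++ zs ≡ map (f ∘ g) xs ++ (map (f ∘ h) ys ++ zs)
map-map-++-map f g h xs ys zs = begin
  map f (map g xs ++ (map h ys ++ [])) ++ zs
    ≡⟨ cong (_++ zs) (trans (map-++ f (map g xs) _)
         (cong₂ _++_ (sym (map-∘ xs)) (trans (map-++ f (map h ys) []) (cong (_++ []) (sym (map-∘ ys)))))) ⟩
  (map (f ∘ g) xs ++ (map (f ∘ h) ys ++ [])) ++ zs
    ≡⟨ trans (++-assoc (map (f ∘ g) xs) _ zs) (cong (map (f ∘ g) xs ++_) (++-assoc (map (f ∘ h) ys) [] zs)) ⟩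
  map (f ∘ g) xs ++ (map (f ∘ h) ys ++ zs) ∎
  where open ≡-Reasoning

-- Sums over the subsets of a list

-- A subset of xs is encoded as xs with every element tagged by its membership flag.
Selection : Set → Set
Selection A = List (Bool × A)

sumSelections : List A → (Selection A → ℕ) → ℕ
sumSelections []       F = F []
sumSelections (x ∷ xs) F =
  sumSelections xs (λ L → F ((true , x) ∷ L)) + sumSelections xs (λ L → F ((false , x) ∷ L))

sumSelections-cong : ∀ (xs : List A) {F G : Selection A → ℕ} →
  (∀ L → F L ≡ G L) → sumSelections xs F ≡ sumSelections xs G
sumSelections-cong []       F≗G = F≗G []
sumSelections-cong (x ∷ xs) F≗G =
  cong₂ _+_ (sumSelections-cong xs λ L → F≗G ((true , x) ∷ L))
            (sumSelections-cong xs λ L → F≗G ((false , x) ∷ L))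

sumSelections-map-++ : ∀ (f : A → B) xs ys (F : Selection B → ℕ) →
  sumSelections (map f xs ++ ys) F ≡
  sumSelections xs (λ L → sumSelections ys (λ M → F (map (map₂ f) L ++ M)))
sumSelections-map-++ f []       ys F = refl
sumSelections-map-++ f (x ∷ xs) ys F =
  cong₂ _+_ (sumSelections-map-++ f xs ys _) (sumSelections-map-++ f xs ys _)

sumSelections-+ : ∀ (xs : List A) (F G : Selection A → ℕ) →
  sumSelections xs (λ L → F L + G L) ≡ sumSelections xs F + sumSelections xs G
sumSelections-+ []       F G = refl
sumSelections-+ (x ∷ xs) F G =
  trans (cong₂ _+_ (sumSelections-+ xs (F ∘ (t ∷_)) (G ∘ (t ∷_)))
                   (sumSelections-+ xs (F ∘ (f ∷_)) (G ∘ (f ∷_))))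
        (interchange (sumSelections xs (F ∘ (t ∷_))) (sumSelections xs (G ∘ (t ∷_)))
                     (sumSelections xs (F ∘ (f ∷_))) (sumSelections xs (G ∘ (f ∷_))))
  where t = true , x
        f = false , x

sumSelections-comm : ∀ (xs : List A) (ys : List B) (F : Selection A → Selection B → ℕ) →
  sumSelections xs (λ L → sumSelections ys (λ M → F L M)) ≡
  sumSelections ys (λ M → sumSelections xs (λ L → F L M))
sumSelections-comm []       ys F = refl
sumSelections-comm (x ∷ xs) ys F =
  trans (cong₂ _+_ (sumSelections-comm xs ys _) (sumSelections-comm xs ys _))
        (sym (sumSelections-+ ys _ _))

sumSelections-*ˡ : ∀ k (xs : List A) (F : Selection A → ℕ) →
  sumSelections xs (λ L → k * F L) ≡ k * sumSelections xs F
sumSelections-*ˡ k []       F = refl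
sumSelections-*ˡ k (x ∷ xs) F =
  trans (cong₂ _+_ (sumSelections-*ˡ k xs _) (sumSelections-*ˡ k xs _))
        (sym (*-distribˡ-+ k _ _))

sumSelections-const : ∀ (xs : List A) k → sumSelections xs (λ _ → k) ≡ 2 ^ length xs * k
sumSelections-const []       k = sym (+-identityʳ k)
sumSelections-const (x ∷ xs) k = begin
  sumSelections xs (λ _ → k) + sumSelections xs (λ _ → k) ≡⟨ cong₂ _+_ ih (trans ih (sym (+-identityʳ _))) ⟩
  2 ^ length xs * k + (2 ^ length xs * k + 0)             ≡⟨ *-assoc 2 (2 ^ length xs) k ⟨
  2 ^ length (x ∷ xs) * k                                 ∎
  where
  open ≡-Reasoning
  ih = sumSelections-const xs k

parity : (A → Bool) → Selection A → Bool
parity p []             = false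
parity p ((t , x) ∷ L) = (t ∧ p x) xor parity p L

parity-cong : ∀ {p q : A → Bool} L → (∀ x → p x ≡ q x) → parity p L ≡ parity q L
parity-cong []             p≗q = refl
parity-cong ((t , x) ∷ L) p≗q = cong₂ (λ px r → (t ∧ px) xor r) (p≗q x) (parity-cong L p≗q)

parity-false : ∀ (L : Selection A) → parity (λ _ → false) L ≡ false
parity-false []             = refl
parity-false ((t , x) ∷ L) = cong₂ _xor_ (∧-zeroʳ t) (parity-false L)

parity-∨-false : ∀ (p : A → Bool) L → parity (λ x → p x ∨ false) L ≡ parity p L
parity-∨-false p L = parity-cong L (λ x → ∨-identityʳ (p x))

parity-∧ˡ : ∀ b (p : A → Bool) L → parity (λ x → b ∧ p x) L ≡ b ∧ parity p L
parity-∧ˡ true  p L = refl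
parity-∧ˡ false p L = parity-false L

parity-map-++ : ∀ (p : B → Bool) (f : A → B) L M →
  parity p (map (map₂ f) L ++ M) ≡ parity (p ∘ f) L xor parity p M
parity-map-++ p f []             M = refl
parity-map-++ p f ((t , x) ∷ L) M =
  trans (cong ((t ∧ p (f x)) xor_) (parity-map-++ p f L M)) (sym (xor-assoc (t ∧ p (f x)) _ _))

length-filterᵇ : ∀ (p : A → Bool) xs → length (filterᵇ p xs) ≡ sum (map (indicator ∘ p) xs)
length-filterᵇ p []       = refl
length-filterᵇ p (x ∷ xs) with p x
... | true  = cong suc (length-filterᵇ p xs)
... | false = length-filterᵇ p xs

sum-map-map-++ : ∀ (g : B → ℕ) (f : A → B) xs ys →
  sum (map g (map f xs ++ ys)) ≡ sum (map (g ∘ f) xs) + sum (map g ys)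
sum-map-map-++ g f []       ys = refl
sum-map-map-++ g f (x ∷ xs) ys = trans (cong (g (f x) +_) (sum-map-map-++ g f xs ys)) (sym (+-assoc (g (f x)) _ _))

sum-allSubsets : ∀ (xs : List A) (F : Selection A → ℕ) →
  sum (map (λ S → F (zip S xs)) (allSubsets (length xs))) ≡ sumSelections xs F
sum-allSubsets []       F = +-identityʳ (F [])
sum-allSubsets (x ∷ xs) F =
  trans (sum-map-map-++ G (true ∷_) S _)
        (cong₂ _+_ (sum-allSubsets xs _)
                   (trans (sum-map-map-++ G (false ∷_) S []) (trans (+-identityʳ _) (sum-allSubsets xs _))))
  where
  S = allSubsets (length xs)
  G = λ S → F (zip S (x ∷ xs))

count-allSubsets : ∀ (xs : List A) (P : Selection A → Bool) →
  length (filterᵇ (λ S → P (zip S xs)) (allSubsets (length xs))) ≡ sumSelections xs (indicator ∘ P)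
count-allSubsets xs P = trans (length-filterᵇ _ (allSubsets (length xs))) (sum-allSubsets xs (indicator ∘ P))

prefixed : (Fin 3 → Selection (Word n)) → Selection (Word (suc n))
prefixed Ls =
  map (map₂ (𝟘 ∷_)) (Ls 𝟘) ++ (map (map₂ (𝟙 ∷_)) (Ls 𝟙) ++ (map (map₂ (𝟚 ∷_)) (Ls 𝟚) ++ []))

sumSelections-allWords-suc : ∀ n (F : Selection (Word (suc n)) → ℕ) →
  sumSelections (allWords (suc n)) F ≡
  sumSelections (allWords n) λ L₀ → sumSelections (allWords n) λ L₁ → sumSelections (allWords n) λ L₂ →
    F (prefixed (lookup (L₀ ∷ L₁ ∷ L₂ ∷ [])))
sumSelections-allWords-suc n F =
  trans (sumSelections-map-++ (𝟘 ∷_) W _ F) (sumSelections-cong W λ L₀ →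
  trans (sumSelections-map-++ (𝟙 ∷_) W _ _) (sumSelections-cong W λ L₁ →
  sumSelections-map-++ (𝟚 ∷_) W [] _))
  where W = allWords n

allᵇ-allWords-suc : ∀ n (p : Word (suc n) → Bool) →
  allᵇ p (allWords (suc n)) ≡
  allᵇ (p ∘ (𝟘 ∷_)) (allWords n) ∧ (allᵇ (p ∘ (𝟙 ∷_)) (allWords n) ∧ allᵇ (p ∘ (𝟚 ∷_)) (allWords n))
allᵇ-allWords-suc n p =
  trans (allᵇ-map-++ p (𝟘 ∷_) W _) (cong (_∧_ _) (
  trans (allᵇ-map-++ p (𝟙 ∷_) W _) (cong (_∧_ _) (
  trans (allᵇ-map-++ p (𝟚 ∷_) W []) (∧-identityʳ _)))))
  where W = allWords n

filterᵇ-allWords-suc : ∀ n (p : Word (suc n) → Bool) →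
  filterᵇ p (allWords (suc n)) ≡
  map (𝟘 ∷_) (filterᵇ (p ∘ (𝟘 ∷_)) (allWords n)) ++ (map (𝟙 ∷_) (filterᵇ (p ∘ (𝟙 ∷_)) (allWords n)) ++
  (map (𝟚 ∷_) (filterᵇ (p ∘ (𝟚 ∷_)) (allWords n)) ++ []))
filterᵇ-allWords-suc n p =
  trans (filterᵇ-map-++ p (𝟘 ∷_) W _) (cong (_++_ _) (
  trans (filterᵇ-map-++ p (𝟙 ∷_) W _) (cong (_++_ _) (
  filterᵇ-map-++ p (𝟚 ∷_) W []))))
  where W = allWords n

length-allWords : ∀ n → length (allWords n) ≡ 3 ^ n
length-allWords zero    = refl
length-allWords (suc n) =
  trans (trans (length-map-++ (𝟘 ∷_) W _) (cong (length W +_) (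
         trans (length-map-++ (𝟙 ∷_) W _) (cong (length W +_) (length-map-++ (𝟚 ∷_) W [])))))
        (cong (λ k → k + (k + (k + 0))) (length-allWords n))
  where W = allWords n

occurs : Word n → Selection (Word n) → Bool
occurs u = parity (u ==w_)

parity-prefixed : ∀ (p : Word (suc n) → Bool) (Ls : Fin 3 → Selection (Word n)) →
  parity p (prefixed Ls) ≡
  parity (p ∘ (𝟘 ∷_)) (Ls 𝟘) xor (parity (p ∘ (𝟙 ∷_)) (Ls 𝟙) xor (parity (p ∘ (𝟚 ∷_)) (Ls 𝟚) xor false))
parity-prefixed p Ls =
  trans (parity-map-++ p (𝟘 ∷_) (Ls 𝟘) _) (cong (parity (p ∘ (𝟘 ∷_)) (Ls 𝟘) xor_) (
  trans (parity-map-++ p (𝟙 ∷_) (Ls 𝟙) _) (cong (parity (p ∘ (𝟙 ∷_)) (Ls 𝟙) xor_) (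
  parity-map-++ p (𝟚 ∷_) (Ls 𝟚) []))))

occurs-prefixed : ∀ x (u : Word n) (Ls : Fin 3 → Selection (Word n)) →
  occurs (x ∷ u) (prefixed Ls) ≡ occurs u (Ls x)
occurs-prefixed x u Ls = begin
  occurs (x ∷ u) (prefixed Ls)
    ≡⟨ parity-prefixed ((x ∷ u) ==w_) Ls ⟩
  parity (λ w → does (x ≟ 𝟘) ∧ (u ==w w)) (Ls 𝟘) xor (parity (λ w → does (x ≟ 𝟙) ∧ (u ==w w)) (Ls 𝟙) xor
    (parity (λ w → does (x ≟ 𝟚) ∧ (u ==w w)) (Ls 𝟚) xor false))
    ≡⟨ cong₂ _xor_ (parity-∧ˡ (does (x ≟ 𝟘)) (u ==w_) (Ls 𝟘))
         (cong₂ _xor_ (parity-∧ˡ (does (x ≟ 𝟙)) (u ==w_) (Ls 𝟙))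
           (cong (_xor false) (parity-∧ˡ (does (x ≟ 𝟚)) (u ==w_) (Ls 𝟚)))) ⟩
  does (x ≟ 𝟘) ∧ occurs u (Ls 𝟘) xor (does (x ≟ 𝟙) ∧ occurs u (Ls 𝟙) xor
    (does (x ≟ 𝟚) ∧ occurs u (Ls 𝟚) xor false))
    ≡⟨ only x ⟩
  occurs u (Ls x) ∎
  where
  open ≡-Reasoning
  only : ∀ x → does (x ≟ 𝟘) ∧ occurs u (Ls 𝟘) xor (does (x ≟ 𝟙) ∧ occurs u (Ls 𝟙) xor
                 (does (x ≟ 𝟚) ∧ occurs u (Ls 𝟚) xor false)) ≡ occurs u (Ls x)
  only 𝟘 = xor-identityʳ _
  only 𝟙 = xor-identityʳ _
  only 𝟚 = xor-identityʳ _

selectionOf : (Word n → Bool) → Selection (Word n)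
selectionOf {n} h = map (λ w → h w , w) (allWords n)

selectionOf-suc : (h : Word (suc n) → Bool) →
  selectionOf h ≡ prefixed (λ x → selectionOf (h ∘ (x ∷_)))
selectionOf-suc {n} h =
  trans (block 𝟘 _) (cong (_++_ _) (trans (block 𝟙 _) (cong (_++_ _) (block 𝟚 []))))
  where
  block : ∀ x ys → map (λ w → h w , w) (map (x ∷_) (allWords n) ++ ys) ≡
                   map (map₂ (x ∷_)) (selectionOf (h ∘ (x ∷_))) ++ map (λ w → h w , w) ys
  block x ys = trans (map-++ _ (map (x ∷_) (allWords n)) ys)
                     (cong (_++ _) (trans (sym (map-∘ (allWords n))) (map-∘ (allWords n))))

occurs-selectionOf : ∀ n (h : Word n → Bool) u → occurs u (selectionOf h) ≡ h u
occurs-selectionOf zero    h [] with h []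
... | true  = refl
... | false = refl
occurs-selectionOf (suc n) h (x ∷ u) =
  trans (cong (occurs (x ∷ u)) (selectionOf-suc h))
        (trans (occurs-prefixed x u (λ y → selectionOf (h ∘ (y ∷_)))) (occurs-selectionOf n (h ∘ (x ∷_)) u))

realises : Selection (Word n) → (Word n → Bool) → Bool
realises {n} L h = allᵇ (λ u → not (occurs u L xor h u)) (allWords n)

realises-prefixed : ∀ (Ls : Fin 3 → Selection (Word n)) (h : Word (suc n) → Bool) →
  realises (prefixed Ls) h ≡
  realises (Ls 𝟘) (h ∘ (𝟘 ∷_)) ∧ (realises (Ls 𝟙) (h ∘ (𝟙 ∷_)) ∧ realises (Ls 𝟚) (h ∘ (𝟚 ∷_)))
realises-prefixed {n} Ls h =
  trans (allᵇ-allWords-suc n _) (cong₂ _∧_ (block 𝟘) (cong₂ _∧_ (block 𝟙) (block 𝟚)))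
  where
  block : ∀ x → allᵇ (λ u → not (occurs (x ∷ u) (prefixed Ls) xor h (x ∷ u))) (allWords n) ≡
                realises (Ls x) (h ∘ (x ∷_))
  block x = allᵇ-cong (allWords n) λ u → cong (λ o → not (o xor h (x ∷ u))) (occurs-prefixed x u Ls)

indicator-realises-prefixed : ∀ (Ls : Fin 3 → Selection (Word n)) h k →
  indicator (realises (prefixed Ls) h) * k ≡
  indicator (realises (Ls 𝟘) (h ∘ (𝟘 ∷_))) *
  (indicator (realises (Ls 𝟙) (h ∘ (𝟙 ∷_))) * (indicator (realises (Ls 𝟚) (h ∘ (𝟚 ∷_))) * k))
indicator-realises-prefixed Ls h k =
  trans (cong (λ r → indicator r * k) (realises-prefixed Ls h))
        (trans (indicator-∧-* r₀ _ k) (cong (indicator r₀ *_) (indicator-∧-* r₁ _ k)))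
  where
  r₀ = realises (Ls 𝟘) (h ∘ (𝟘 ∷_))
  r₁ = realises (Ls 𝟙) (h ∘ (𝟙 ∷_))

sumSelections-realises : ∀ n (h : Word n → Bool) (G : Selection (Word n) → ℕ) →
  sumSelections (allWords n) (λ L → indicator (realises L h) * G L) ≡ G (selectionOf h)
sumSelections-realises zero h G with h []
... | true  = trans (+-identityʳ _) (*-identityˡ _)
... | false = *-identityˡ _
sumSelections-realises (suc n) h G = begin
  sumSelections (allWords (suc n)) (λ L → indicator (realises L h) * G L)
    ≡⟨ sumSelections-allWords-suc n _ ⟩
  (sumSelections W λ L₀ → sumSelections W λ L₁ → sumSelections W λ L₂ →
     indicator (realises (prefixed (blocks L₀ L₁ L₂)) h) * G (prefixed (blocks L₀ L₁ L₂)))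
    ≡⟨ (sumSelections-cong W λ L₀ → sumSelections-cong W λ L₁ → sumSelections-cong W λ L₂ →
        indicator-realises-prefixed (blocks L₀ L₁ L₂) h _) ⟩
  (sumSelections W λ L₀ → sumSelections W λ L₁ → sumSelections W λ L₂ →
     i₀ L₀ * (i₁ L₁ * (i₂ L₂ * G (prefixed (blocks L₀ L₁ L₂)))))
    ≡⟨ (sumSelections-cong W λ L₀ → sumSelections-cong W λ L₁ →
        trans (sumSelections-*ˡ (i₀ L₀) W _) (cong (i₀ L₀ *_)
       (trans (sumSelections-*ˡ (i₁ L₁) W _) (cong (i₁ L₁ *_)
       (sumSelections-realises n h₂ (λ L₂ → G (prefixed (blocks L₀ L₁ L₂)))))))) ⟩
  (sumSelections W λ L₀ → sumSelections W λ L₁ → i₀ L₀ * (i₁ L₁ * G (prefixed (blocks L₀ L₁ s₂))))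
    ≡⟨ (sumSelections-cong W λ L₀ →
        trans (sumSelections-*ˡ (i₀ L₀) W _) (cong (i₀ L₀ *_)
       (sumSelections-realises n h₁ (λ L₁ → G (prefixed (blocks L₀ L₁ s₂)))))) ⟩
  (sumSelections W λ L₀ → i₀ L₀ * G (prefixed (blocks L₀ s₁ s₂)))
    ≡⟨ sumSelections-realises n h₀ (λ L₀ → G (prefixed (blocks L₀ s₁ s₂))) ⟩
  G (prefixed (blocks s₀ s₁ s₂))
    ≡⟨ cong G (selectionOf-suc h) ⟨
  G (selectionOf h) ∎
  where
  open ≡-Reasoning
  W = allWords n
  blocks : (L₀ L₁ L₂ : Selection (Word n)) → Fin 3 → Selection (Word n)
  blocks L₀ L₁ L₂ = lookup (L₀ ∷ L₁ ∷ L₂ ∷ [])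
  h₀ h₁ h₂ : Word n → Bool
  h₀ = h ∘ (𝟘 ∷_)
  h₁ = h ∘ (𝟙 ∷_)
  h₂ = h ∘ (𝟚 ∷_)
  s₀ = selectionOf h₀
  s₁ = selectionOf h₁
  s₂ = selectionOf h₂
  i₀ i₁ i₂ : Selection (Word n) → ℕ
  i₀ L = indicator (realises L h₀)
  i₁ L = indicator (realises L h₁)
  i₂ L = indicator (realises L h₂)

-- The edges of Σₙ

representatives : ∀ n → Gen → List (Word n)
representatives n s = filterᵇ (λ w → w <w act s w) (allWords n)

edges-byLabel : ∀ n → edges n ≡
  map (a ,_) (representatives n a) ++ (map (b ,_) (representatives n b) ++ (map (c ,_) (representatives n c) ++ []))
edges-byLabel n =
  trans (filterᵇ-map-++ _ (a ,_) (allWords n) _) (cong (_++_ _) (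
  trans (filterᵇ-map-++ _ (b ,_) (allWords n) _) (cong (_++_ _) (
  filterᵇ-map-++ _ (c ,_) (allWords n) []))))

representatives-suc-a : ∀ n →
  representatives (suc n) a ≡ map (𝟘 ∷_) (allWords n) ++ (map (𝟚 ∷_) (representatives n a) ++ [])
representatives-suc-a n =
  trans (filterᵇ-allWords-suc n _)
        (cong₂ (λ X Y → map (𝟘 ∷_) X ++ (map (𝟙 ∷_) Y ++ (map (𝟚 ∷_) (representatives n a) ++ [])))
               (filterᵇ-true (allWords n)) (filterᵇ-false (allWords n)))

representatives-suc-b : ∀ n →
  representatives (suc n) b ≡ map (𝟘 ∷_) (allWords n) ++ (map (𝟙 ∷_) (representatives n b) ++ [])
representatives-suc-b n =
  trans (filterᵇ-allWords-suc n _)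
        (cong₂ (λ X Y → map (𝟘 ∷_) X ++ (map (𝟙 ∷_) (representatives n b) ++ (map (𝟚 ∷_) Y ++ [])))
               (filterᵇ-true (allWords n)) (filterᵇ-false (allWords n)))

representatives-suc-c : ∀ n →
  representatives (suc n) c ≡ map (𝟘 ∷_) (representatives n c) ++ (map (𝟙 ∷_) (allWords n) ++ [])
representatives-suc-c n =
  trans (filterᵇ-allWords-suc n _)
        (cong₂ (λ X Y → map (𝟘 ∷_) (representatives n c) ++ (map (𝟙 ∷_) X ++ (map (𝟚 ∷_) Y ++ [])))
               (filterᵇ-true (allWords n)) (filterᵇ-false (allWords n)))

edgeAt : Gen → Fin 3 → Word n → Edge (suc n)
edgeAt s x w = s , x ∷ w

-- Σₙ₊₁ consists of the blocks 0Σₙ, 1Σₙ, 2Σₙ, joined pairwise by the perfect matchings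
-- 0w–1w (label a), 0w–2w (label b) and 1w–2w (label c); besides these, the block 0Σₙ
-- carries a copy of the c-edges of Σₙ, 1Σₙ of the b-edges and 2Σₙ of the a-edges.
edges-suc : ∀ n → edges (suc n) ≡
  map (edgeAt a 𝟘) (allWords n) ++ (map (edgeAt a 𝟚) (representatives n a) ++
  (map (edgeAt b 𝟘) (allWords n) ++ (map (edgeAt b 𝟙) (representatives n b) ++
  (map (edgeAt c 𝟘) (representatives n c) ++ (map (edgeAt c 𝟙) (allWords n) ++ [])))))
edges-suc n = begin
  edges (suc n)
    ≡⟨ edges-byLabel (suc n) ⟩
  map (a ,_) (R (suc n) a) ++ (map (b ,_) (R (suc n) b) ++ (map (c ,_) (R (suc n) c) ++ []))
    ≡⟨ cong₂ _++_ (cong (map (a ,_)) (representatives-suc-a n))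
         (cong₂ _++_ (cong (map (b ,_)) (representatives-suc-b n))
                     (cong (λ X → map (c ,_) X ++ []) (representatives-suc-c n))) ⟩
  map (a ,_) (map (𝟘 ∷_) W ++ (map (𝟚 ∷_) (R n a) ++ [])) ++
  (map (b ,_) (map (𝟘 ∷_) W ++ (map (𝟙 ∷_) (R n b) ++ [])) ++
  (map (c ,_) (map (𝟘 ∷_) (R n c) ++ (map (𝟙 ∷_) W ++ [])) ++ []))
    ≡⟨ trans (map-map-++-map (a ,_) (𝟘 ∷_) (𝟚 ∷_) W (R n a) _) (cong (λ X → A₀ ++ (A₂ ++ X)) (
       trans (map-map-++-map (b ,_) (𝟘 ∷_) (𝟙 ∷_) W (R n b) _) (cong (λ X → B₀ ++ (B₁ ++ X)) (
       map-map-++-map (c ,_) (𝟘 ∷_) (𝟙 ∷_) (R n c) W [])))) ⟩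
  _ ∎
  where
  open ≡-Reasoning
  W = allWords n
  R = representatives
  A₀ = map (edgeAt a 𝟘) W
  A₂ = map (edgeAt a 𝟚) (R n a)
  B₀ = map (edgeAt b 𝟘) W
  B₁ = map (edgeAt b 𝟙) (R n b)

-- Closed polygons

oddDegree-parity : ∀ (v : Word n) L → oddDegree v L ≡ parity (incident v) L
oddDegree-parity v []             = refl
oddDegree-parity v ((t , e) ∷ L) = cong ((t ∧ incident v e) xor_) (oddDegree-parity v L)

closed : ∀ n → Selection (Edge n) → Bool
closed n L = allᵇ (λ v → not (oddDegree v L)) (allWords n)

closedCount : ℕ → ℕ
closedCount n = sumSelections (edges n) (indicator ∘ closed n)

numClosedPolygons≡closedCount : ∀ n → numClosedPolygons n ≡ closedCount n
numClosedPolygons≡closedCount n = count-allSubsets (edges n) (closed n)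

degreeIn : Gen → Word n → Selection (Word n) → Bool
degreeIn s u = parity (λ w → incident u (s , w))

balanced : (LA LB LC : Selection (Word n)) → Bool
balanced {n} LA LB LC =
  allᵇ (λ u → not (degreeIn a u LA xor (degreeIn b u LB xor degreeIn c u LC))) (allWords n)

closedCount-byLabel : ∀ n → closedCount n ≡
  (sumSelections (representatives n a) λ LA → sumSelections (representatives n b) λ LB →
   sumSelections (representatives n c) λ LC → indicator (balanced LA LB LC))
closedCount-byLabel n =
  trans (cong (λ E → sumSelections E (indicator ∘ closed n)) (edges-byLabel n))
  (trans (sumSelections-map-++ (tag a) (R a) _ _) (sumSelections-cong (R a) λ LA →
   trans (sumSelections-map-++ (tag b) (R b) _ _) (sumSelections-cong (R b) λ LB →
   trans (sumSelections-map-++ (tag c) (R c) [] _) (sumSelections-cong (R c) λ LC →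
   cong indicator (allᵇ-cong (allWords n) λ u → cong not (degree LA LB LC u))))))
  where
  R = representatives n
  tag : Gen → Word n → Edge n
  tag s w = s , w
  labelled : (LA LB LC : Selection (Word n)) → Selection (Edge n)
  labelled LA LB LC = map (map₂ (tag a)) LA ++ (map (map₂ (tag b)) LB ++ (map (map₂ (tag c)) LC ++ []))
  degree : ∀ LA LB LC u →
    oddDegree u (labelled LA LB LC) ≡
    degreeIn a u LA xor (degreeIn b u LB xor degreeIn c u LC)
  degree LA LB LC u =
    trans (oddDegree-parity u (labelled LA LB LC))
    (trans (parity-map-++ (incident u) (tag a) LA _) (cong (degreeIn a u LA xor_) (
     trans (parity-map-++ (incident u) (tag b) LB _) (cong (degreeIn b u LB xor_) (
     trans (parity-map-++ (incident u) (tag c) LC []) (xor-identityʳ _))))))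

lifted : (L₀₁ LA L₀₂ LB LC L₁₂ : Selection (Word n)) → Selection (Edge (suc n))
lifted L₀₁ LA L₀₂ LB LC L₁₂ =
  map (map₂ (edgeAt a 𝟘)) L₀₁ ++ (map (map₂ (edgeAt a 𝟚)) LA ++
  (map (map₂ (edgeAt b 𝟘)) L₀₂ ++ (map (map₂ (edgeAt b 𝟙)) LB ++
  (map (map₂ (edgeAt c 𝟘)) LC ++ (map (map₂ (edgeAt c 𝟙)) L₁₂ ++ [])))))

sumSelections-lifted : ∀ n (F : Selection (Edge (suc n)) → ℕ) →
  sumSelections (edges (suc n)) F ≡
  (sumSelections (allWords n) λ L₀₁ → sumSelections (representatives n a) λ LA →
   sumSelections (allWords n) λ L₀₂ → sumSelections (representatives n b) λ LB →
   sumSelections (representatives n c) λ LC → sumSelections (allWords n) λ L₁₂ →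
   F (lifted L₀₁ LA L₀₂ LB LC L₁₂))
sumSelections-lifted n F =
  trans (cong (λ E → sumSelections E F) (edges-suc n))
  (trans (sumSelections-map-++ (edgeAt a 𝟘) W _ _) (sumSelections-cong W λ L₀₁ →
   trans (sumSelections-map-++ (edgeAt a 𝟚) (R a) _ _) (sumSelections-cong (R a) λ LA →
   trans (sumSelections-map-++ (edgeAt b 𝟘) W _ _) (sumSelections-cong W λ L₀₂ →
   trans (sumSelections-map-++ (edgeAt b 𝟙) (R b) _ _) (sumSelections-cong (R b) λ LB →
   trans (sumSelections-map-++ (edgeAt c 𝟘) (R c) _ _) (sumSelections-cong (R c) λ LC →
   sumSelections-map-++ (edgeAt c 𝟙) W [] _))))))
  where
  W = allWords n
  R = representatives n

oddDegree-lifted : ∀ (v : Word (suc n)) L₀₁ LA L₀₂ LB LC L₁₂ →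
  oddDegree v (lifted L₀₁ LA L₀₂ LB LC L₁₂) ≡
  parity (incident v ∘ edgeAt a 𝟘) L₀₁ xor (parity (incident v ∘ edgeAt a 𝟚) LA xor
  (parity (incident v ∘ edgeAt b 𝟘) L₀₂ xor (parity (incident v ∘ edgeAt b 𝟙) LB xor
  (parity (incident v ∘ edgeAt c 𝟘) LC xor (parity (incident v ∘ edgeAt c 𝟙) L₁₂ xor false)))))
oddDegree-lifted v L₀₁ LA L₀₂ LB LC L₁₂ =
  trans (oddDegree-parity v (lifted L₀₁ LA L₀₂ LB LC L₁₂))
  (trans (parity-map-++ i (edgeAt a 𝟘) L₀₁ _) (cong (parity (i ∘ edgeAt a 𝟘) L₀₁ xor_) (
   trans (parity-map-++ i (edgeAt a 𝟚) LA _) (cong (parity (i ∘ edgeAt a 𝟚) LA xor_) (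
   trans (parity-map-++ i (edgeAt b 𝟘) L₀₂ _) (cong (parity (i ∘ edgeAt b 𝟘) L₀₂ xor_) (
   trans (parity-map-++ i (edgeAt b 𝟙) LB _) (cong (parity (i ∘ edgeAt b 𝟙) LB xor_) (
   trans (parity-map-++ i (edgeAt c 𝟘) LC _) (cong (parity (i ∘ edgeAt c 𝟘) LC xor_) (
   parity-map-++ i (edgeAt c 𝟙) L₁₂ [])))))))))))
  where i = incident v

closed-lifted : ∀ (L₀₁ LA L₀₂ LB LC L₁₂ : Selection (Word n)) →
  closed (suc n) (lifted L₀₁ LA L₀₂ LB LC L₁₂) ≡
  realises L₀₂ (λ u → occurs u L₀₁ xor degreeIn c u LC) ∧
  (realises L₁₂ (λ u → occurs u L₀₁ xor degreeIn b u LB) ∧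
   allᵇ (λ u → not (degreeIn a u LA xor (occurs u L₀₂ xor occurs u L₁₂))) (allWords n))
closed-lifted {n} L₀₁ LA L₀₂ LB LC L₁₂ =
  trans (allᵇ-allWords-suc n _) (cong₂ _∧_
    (allᵇ-cong (allWords n) λ u → cong not (trans (degree₀ u) (x∙yz≈y∙xz (occurs u L₀₁) (occurs u L₀₂) _)))
    (cong₂ _∧_
      (allᵇ-cong (allWords n) λ u →
         cong not (trans (degree₁ u) (x∙yz≈z∙xy (occurs u L₀₁) (degreeIn b u LB) (occurs u L₁₂))))
      (allᵇ-cong (allWords n) λ u → cong not (degree₂ u))))
  where
  K = lifted L₀₁ LA L₀₂ LB LC L₁₂
  degree₀ : ∀ u → oddDegree (𝟘 ∷ u) K ≡ occurs u L₀₁ xor (occurs u L₀₂ xor degreeIn c u LC)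
  degree₀ u = trans (oddDegree-lifted (𝟘 ∷ u) L₀₁ LA L₀₂ LB LC L₁₂)
    (cong₂ _xor_ (parity-∨-false (u ==w_) L₀₁) (cong₂ _xor_ (parity-false LA)
    (cong₂ _xor_ (parity-∨-false (u ==w_) L₀₂) (cong₂ _xor_ (parity-false LB)
    (trans (cong (λ r → degreeIn c u LC xor (r xor false)) (parity-false L₁₂)) (xor-identityʳ _))))))
  degree₁ : ∀ u → oddDegree (𝟙 ∷ u) K ≡ occurs u L₀₁ xor (degreeIn b u LB xor occurs u L₁₂)
  degree₁ u = trans (oddDegree-lifted (𝟙 ∷ u) L₀₁ LA L₀₂ LB LC L₁₂)
    (cong (occurs u L₀₁ xor_) (cong₂ _xor_ (parity-false LA)
    (cong₂ _xor_ (parity-false L₀₂) (cong (degreeIn b u LB xor_) (cong₂ _xor_ (parity-false LC)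
    (trans (cong (_xor false) (parity-∨-false (u ==w_) L₁₂)) (xor-identityʳ _)))))))
  degree₂ : ∀ u → oddDegree (𝟚 ∷ u) K ≡ degreeIn a u LA xor (occurs u L₀₂ xor occurs u L₁₂)
  degree₂ u = trans (oddDegree-lifted (𝟚 ∷ u) L₀₁ LA L₀₂ LB LC L₁₂)
    (cong₂ _xor_ (parity-false L₀₁) (cong (degreeIn a u LA xor_)
    (cong (occurs u L₀₂ xor_) (cong₂ _xor_ (parity-false LB) (cong₂ _xor_ (parity-false LC)
    (xor-identityʳ _))))))

sumSelections-bridge₁₂ : ∀ (L₀₁ LA L₀₂ LB LC : Selection (Word n)) →
  sumSelections (allWords n) (λ L₁₂ → indicator (closed (suc n) (lifted L₀₁ LA L₀₂ LB LC L₁₂))) ≡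
  indicator (realises L₀₂ (λ u → occurs u L₀₁ xor degreeIn c u LC)) *
  indicator (allᵇ (λ u → not (degreeIn a u LA xor (occurs u L₀₂ xor (occurs u L₀₁ xor degreeIn b u LB)))) (allWords n))
sumSelections-bridge₁₂ {n} L₀₁ LA L₀₂ LB LC = begin
  sumSelections W (λ L₁₂ → indicator (closed (suc n) (lifted L₀₁ LA L₀₂ LB LC L₁₂)))
    ≡⟨ (sumSelections-cong W λ L₁₂ →
        trans (cong indicator (closed-lifted L₀₁ LA L₀₂ LB LC L₁₂))
              (trans (indicator-∧ r₀₂ _) (cong (indicator r₀₂ *_) (indicator-∧ (realises L₁₂ h₁₂) _)))) ⟩
  sumSelections W (λ L₁₂ → indicator r₀₂ * (indicator (realises L₁₂ h₁₂) * indicator (rest L₁₂)))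
    ≡⟨ sumSelections-*ˡ (indicator r₀₂) W _ ⟩
  indicator r₀₂ * sumSelections W (λ L₁₂ → indicator (realises L₁₂ h₁₂) * indicator (rest L₁₂))
    ≡⟨ cong (indicator r₀₂ *_) (sumSelections-realises n h₁₂ (indicator ∘ rest)) ⟩
  indicator r₀₂ * indicator (rest (selectionOf h₁₂))
    ≡⟨ cong (λ r → indicator r₀₂ * indicator r) (allᵇ-cong W λ u →
         cong (λ o → not (degreeIn a u LA xor (occurs u L₀₂ xor o))) (occurs-selectionOf n h₁₂ u)) ⟩
  indicator r₀₂ * indicator (allᵇ (λ u → not (degreeIn a u LA xor (occurs u L₀₂ xor h₁₂ u))) W) ∎
  where
  open ≡-Reasoning
  W = allWords n
  r₀₂ = realises L₀₂ (λ u → occurs u L₀₁ xor degreeIn c u LC)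
  h₁₂ : Word n → Bool
  h₁₂ u = occurs u L₀₁ xor degreeIn b u LB
  rest : Selection (Word n) → Bool
  rest L₁₂ = allᵇ (λ u → not (degreeIn a u LA xor (occurs u L₀₂ xor occurs u L₁₂))) W

sumSelections-bridge₀₂ : ∀ (L₀₁ LA LB LC : Selection (Word n)) →
  sumSelections (allWords n) (λ L₀₂ →
    indicator (realises L₀₂ (λ u → occurs u L₀₁ xor degreeIn c u LC)) *
    indicator (allᵇ (λ u → not (degreeIn a u LA xor (occurs u L₀₂ xor (occurs u L₀₁ xor degreeIn b u LB))))
                    (allWords n)))
  ≡ indicator (balanced LA LB LC)
sumSelections-bridge₀₂ {n} L₀₁ LA LB LC =
  trans (sumSelections-realises n _ _) (cong indicator (allᵇ-cong (allWords n) λ u →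
    cong (λ o → not (degreeIn a u LA xor o))
      (trans (cong (_xor (occurs u L₀₁ xor degreeIn b u LB)) (occurs-selectionOf n _ u))
             (xor-cancel (occurs u L₀₁) (degreeIn b u LB) (degreeIn c u LC)))))

closedCount-suc : ∀ n → closedCount (suc n) ≡ 2 ^ 3 ^ n * closedCount n
closedCount-suc n = begin
  closedCount (suc n)
    ≡⟨ sumSelections-lifted n _ ⟩
  (sumSelections W λ L₀₁ → sumSelections (R a) λ LA → sumSelections W λ L₀₂ →
   sumSelections (R b) λ LB → sumSelections (R c) λ LC → sumSelections W λ L₁₂ →
   indicator (closed (suc n) (lifted L₀₁ LA L₀₂ LB LC L₁₂)))
    ≡⟨ (sumSelections-cong W λ L₀₁ → sumSelections-cong (R a) λ LA →
        sumSelections-cong W λ L₀₂ → sumSelections-cong (R b) λ LB → sumSelections-cong (R c) λ LC →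
        sumSelections-bridge₁₂ L₀₁ LA L₀₂ LB LC) ⟩
  (sumSelections W λ L₀₁ → sumSelections (R a) λ LA → sumSelections W λ L₀₂ →
   sumSelections (R b) λ LB → sumSelections (R c) λ LC → F L₀₁ LA L₀₂ LB LC)
    ≡⟨ (sumSelections-cong W λ L₀₁ → sumSelections-cong (R a) λ LA →
        trans (sumSelections-comm W (R b) _) (sumSelections-cong (R b) λ LB → sumSelections-comm W (R c) _)) ⟩
  (sumSelections W λ L₀₁ → sumSelections (R a) λ LA → sumSelections (R b) λ LB →
   sumSelections (R c) λ LC → sumSelections W λ L₀₂ → F L₀₁ LA L₀₂ LB LC)
    ≡⟨ (sumSelections-cong W λ L₀₁ → sumSelections-cong (R a) λ LA →
        sumSelections-cong (R b) λ LB → sumSelections-cong (R c) λ LC →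
        sumSelections-bridge₀₂ L₀₁ LA LB LC) ⟩
  (sumSelections W λ _ → sumSelections (R a) λ LA → sumSelections (R b) λ LB →
   sumSelections (R c) λ LC → indicator (balanced LA LB LC))
    ≡⟨ sumSelections-const W _ ⟩
  2 ^ length W * (sumSelections (R a) λ LA → sumSelections (R b) λ LB →
                  sumSelections (R c) λ LC → indicator (balanced LA LB LC))
    ≡⟨ cong₂ (λ k m → 2 ^ k * m) (length-allWords n) (sym (closedCount-byLabel n)) ⟩
  2 ^ 3 ^ n * closedCount n ∎
  where
  open ≡-Reasoning
  W = allWords n
  R = representatives n
  F : (L₀₁ LA L₀₂ LB LC : Selection (Word n)) → ℕ
  F L₀₁ LA L₀₂ LB LC =
    indicator (realises L₀₂ (λ u → occurs u L₀₁ xor degreeIn c u LC)) *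
    indicator (allᵇ (λ u → not (degreeIn a u LA xor (occurs u L₀₂ xor (occurs u L₀₁ xor degreeIn b u LB)))) W)

-- The exponent

cycleRank : ℕ → ℕ
cycleRank zero    = 0
cycleRank (suc n) = 3 ^ n + cycleRank n

closedCount≡2^cycleRank : ∀ n → closedCount n ≡ 2 ^ cycleRank n
closedCount≡2^cycleRank zero    = refl
closedCount≡2^cycleRank (suc n) =
  trans (closedCount-suc n)
        (trans (cong (2 ^ 3 ^ n *_) (closedCount≡2^cycleRank n)) (sym (^-distribˡ-+-* 2 (3 ^ n) (cycleRank n))))

3^n≡1+cycleRank*2 : ∀ n → 3 ^ n ≡ suc (cycleRank n * 2)
3^n≡1+cycleRank*2 zero    = refl
3^n≡1+cycleRank*2 (suc n) rewrite 3^n≡1+cycleRank*2 n = triple (cycleRank n)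
  where
  triple : ∀ r → 3 * suc (r * 2) ≡ suc ((suc (r * 2) + r) * 2)
  triple = solve-∀

[3^n∸1]/2≡cycleRank : ∀ n → (3 ^ n ∸ 1) / 2 ≡ cycleRank n
[3^n∸1]/2≡cycleRank n rewrite 3^n≡1+cycleRank*2 n = m*n/n≡m (cycleRank n) 2

mainTheorem6 : (n : ℕ) → 1 ≤ n → numClosedPolygons n ≡ 2 ^ ((3 ^ n ∸ 1) / 2)
mainTheorem6 n _ = begin
  numClosedPolygons n      ≡⟨ numClosedPolygons≡closedCount n ⟩
  closedCount n            ≡⟨ closedCount≡2^cycleRank n ⟩
  2 ^ cycleRank n          ≡⟨ cong (2 ^_) ([3^n∸1]/2≡cycleRank n) ⟨
  2 ^ ((3 ^ n ∸ 1) / 2)    ∎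
  where open ≡-Reasoning
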